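{- Let $k\geq 1$. If $m\geq n\geq 2$ and $m\geq k$, then $\gamma_{\times k,t}(K_n\Box K_m)\leq kn$, with equality when $m\geq kn-1$. If $m\geq k+1$, then $\gamma_{\times k,t}(K_1\Box K_m)=k+1$.
   Context: $K_n$ is the complete graph on $n$ vertices and $K_n\Box K_m$ is the Cartesian product (the $n\times m$ rook's graph): vertex set $V(K_n)\times V(K_m)$, two distinct vertices adjacent iff they agree in exactly one coordinate. A $k$-tuple total dominating set of a graph is a set $S$ of vertices such that every vertex has at least $k$ neighbors in $S$; $\gamma_{\times k,t}$ denotes the minimum size of such a set. -}

module Defs where

open import Data.Nat using (ℕ; _+_; _≤_)
open import Data.Bool using (Bool; true; false; if_then_else_; _∧_; _∨_; not)
open import Data.Fin using (Fin)
open import Data.Fin.Properties using () renaming (_≟_ to _≟ᶠ_)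
open import Data.List using (List; map; allFin; concatMap)
open import Data.Nat.ListAction using (sum)
open import Relation.Binary.PropositionalEquality using (_≡_)
open import Data.Product using (_×_; _,_; Σ)
open import Relation.Nullary.Decidable using (⌊_⌋)

Vertex : ℕ → ℕ → Set
Vertex n m = Fin n × Fin m

vertices : (n m : ℕ) → List (Vertex n m)
vertices n m = concatMap (λ i → map (λ j → (i , j)) (allFin m)) (allFin n)

adj : {n m : ℕ} → Vertex n m → Vertex n m → Bool
adj (i , j) (i' , j') =
  (⌊ i ≟ᶠ i' ⌋ ∧ not ⌊ j ≟ᶠ j' ⌋) ∨ (not ⌊ i ≟ᶠ i' ⌋ ∧ ⌊ j ≟ᶠ j' ⌋)

VSet : ℕ → ℕ → Set
VSet n m = Vertex n m → Bool

count : {A : Set} → (A → Bool) → List A → ℕ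
count p xs = sum (map (λ x → if p x then 1 else 0) xs)

size : {n m : ℕ} → VSet n m → ℕ
size {n} {m} S = count S (vertices n m)

nbrsIn : {n m : ℕ} → VSet n m → Vertex n m → ℕ
nbrsIn {n} {m} S v = count (λ u → adj v u ∧ S u) (vertices n m)

IsKTDS : (k n m : ℕ) → VSet n m → Set
IsKTDS k n m S = (v : Vertex n m) → k ≤ nbrsIn S v

γ≤ : (k n m c : ℕ) → Set
γ≤ k n m c = Σ (VSet n m) λ S → IsKTDS k n m S × size S ≤ c

γ≡ : (k n m c : ℕ) → Set
γ≡ k n m c =
  (Σ (VSet n m) λ S → IsKTDS k n m S × size S ≡ c)
  × ((S : VSet n m) → IsKTDS k n m S → c ≤ size S)

-- Writing s(i,j) ∈ {0,1} for membership of (i,j) in S, every vertex satisfies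
-- nbrs(i,j) + 2 s(i,j) = row(i) + column(j). If S consists of whole columns C,
-- then row(i) = |C| and column(j) = n s(i,j), so S is |C|-tuple total
-- dominating once n ≥ 2; k columns give the upper bound kn, and for n = 1 the
-- set of k + 1 columns works. Conversely, either every row of a k-tuple total
-- dominating set S has k cells, so |S| ≥ kn, or some row i has r < k cells;
-- summing the identity along row i gives m k + 2 r ≤ m r + |S|, which forces
-- |S| ≥ kn when kn ≤ m + 1. On a single row the identity reads
-- nbrs(j) + s(j) = |S|, and some cell is occupied, so |S| ≥ k + 1.
module Submission where

open import Defs
open import Data.Nat using (ℕ; zero; suc; _+_; _*_; _≤_; _<_; _<ᵇ_; z≤n; s≤s; _≤?_)
open import Data.Nat.Properties hiding (_≟_)
open import Data.Nat.ListAction using () renaming (sum to sumᴸ)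
open import Data.Nat.ListAction.Properties using (sum-++)
open import Data.Bool using (Bool; true; false; if_then_else_; _∧_; _∨_; not)
open import Data.Fin using (Fin; toℕ; fromℕ<) renaming (zero to fzero; suc to fsuc)
open import Data.Fin.Properties using (_≟_; all?; ¬∀⟶∃¬)
open import Data.List using (List; _++_; map; concat; tabulate)
open import Data.List.Properties using (map-++; map-tabulate)
open import Data.Product using (Σ; _×_; _,_; ∃; proj₁; proj₂)
open import Function using (_∘_)
open import Relation.Binary.PropositionalEquality
open import Relation.Nullary using (yes; no)
open import Relation.Nullary.Decidable using (⌊_⌋)
open import Algebra.Properties.Semiring.Sum +-*-semiring
  using (sum; sum-syntax; sum-cong-≗; sum-replicate-zero; ∑-comm; ∑-distrib-+; *-distribˡ-sum)

private
  variable
    A : Set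
    k n m : ℕ

indicator : Bool → ℕ
indicator b = if b then 1 else 0

indicator≤1 : ∀ b → indicator b ≤ 1
indicator≤1 true  = ≤-refl
indicator≤1 false = z≤n

∑-const : ∀ n c → ∑[ i < n ] c ≡ n * c
∑-const zero    c = refl
∑-const (suc n) c = cong (c +_) (∑-const n c)

∑-mono-≤ : ∀ {f g : Fin n → ℕ} → (∀ i → f i ≤ g i) → sum f ≤ sum g
∑-mono-≤ {zero}  f≤g = z≤n
∑-mono-≤ {suc n} f≤g = +-mono-≤ (f≤g fzero) (∑-mono-≤ (f≤g ∘ fsuc))

∑-positive : ∀ (f : Fin n → ℕ) → 0 < sum f → ∃ λ i → 0 < f i
∑-positive {suc n} f 0<∑ with f fzero in f₀≡
... | suc _ = fzero , subst (0 <_) (sym f₀≡) (s≤s z≤n)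
... | zero  = let i , 0<fi = ∑-positive (f ∘ fsuc) 0<∑ in fsuc i , 0<fi

-- ⌊_⌋ is stuck on the neutral i ≟ j, so this needs a case split.
⌊suc≟suc⌋ : ∀ (i j : Fin n) → ⌊ fsuc i ≟ fsuc j ⌋ ≡ ⌊ i ≟ j ⌋
⌊suc≟suc⌋ i j with i ≟ j
... | yes _ = refl
... | no  _ = refl

∑-indicator-≟ : ∀ (i : Fin n) (b : Fin n → Bool) →
  ∑[ i′ < n ] indicator (⌊ i ≟ i′ ⌋ ∧ b i′) ≡ indicator (b i)
∑-indicator-≟ {suc n} fzero    b = trans (cong (indicator (b fzero) +_) (sum-replicate-zero n)) (+-identityʳ _)
∑-indicator-≟ {suc n} (fsuc i) b = begin
  ∑[ i′ < n ] indicator (⌊ fsuc i ≟ fsuc i′ ⌋ ∧ b (fsuc i′))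
    ≡⟨ sum-cong-≗ (λ i′ → cong (λ d → indicator (d ∧ b (fsuc i′))) (⌊suc≟suc⌋ i i′)) ⟩
  ∑[ i′ < n ] indicator (⌊ i ≟ i′ ⌋ ∧ b (fsuc i′))
    ≡⟨ ∑-indicator-≟ i (b ∘ fsuc) ⟩
  indicator (b (fsuc i)) ∎
  where open ≡-Reasoning

gridSum : (Fin n → Fin m → ℕ) → ℕ
gridSum {n} {m} f = ∑[ i < n ] ∑[ j < m ] f i j

gridSum-cong : ∀ {f g : Fin n → Fin m → ℕ} → (∀ i j → f i j ≡ g i j) → gridSum f ≡ gridSum g
gridSum-cong f≡g = sum-cong-≗ (λ i → sum-cong-≗ (f≡g i))

gridSum-distrib-+ : ∀ (f g : Fin n → Fin m → ℕ) →
  gridSum (λ i j → f i j + g i j) ≡ gridSum f + gridSum g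
gridSum-distrib-+ f g =
  trans (sum-cong-≗ (λ i → ∑-distrib-+ (f i) (g i))) (∑-distrib-+ (λ i → sum (f i)) (λ i → sum (g i)))

*-distribˡ-gridSum : ∀ c (f : Fin n → Fin m → ℕ) → c * gridSum f ≡ gridSum (λ i j → c * f i j)
*-distribˡ-gridSum c f =
  trans (*-distribˡ-sum c (λ i → sum (f i))) (sum-cong-≗ (λ i → *-distribˡ-sum c (f i)))

count-++ : ∀ (p : A → Bool) xs ys → count p (xs ++ ys) ≡ count p xs + count p ys
count-++ p xs ys = trans (cong sumᴸ (map-++ (indicator ∘ p) xs ys)) (sum-++ (map (indicator ∘ p) xs) _)

count-tabulate : ∀ (p : A → Bool) (f : Fin n → A) →
  count p (tabulate f) ≡ ∑[ i < n ] indicator (p (f i))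
count-tabulate {n = zero}  p f = refl
count-tabulate {n = suc n} p f = cong (indicator (p (f fzero)) +_) (count-tabulate p (f ∘ fsuc))

count-concat-tabulate : ∀ (p : A → Bool) (g : Fin n → List A) →
  count p (concat (tabulate g)) ≡ ∑[ i < n ] count p (g i)
count-concat-tabulate {n = zero}  p g = refl
count-concat-tabulate {n = suc n} p g =
  trans (count-++ p (g fzero) _) (cong (count p (g fzero) +_) (count-concat-tabulate p (g ∘ fsuc)))

count-vertices : ∀ (p : Vertex n m → Bool) →
  count p (vertices n m) ≡ gridSum (λ i j → indicator (p (i , j)))
count-vertices {n} {m} p = begin
  count p (concat (map row (tabulate (λ i → i))))  ≡⟨ cong (count p ∘ concat) (map-tabulate (λ i → i) row) ⟩
  count p (concat (tabulate row))                  ≡⟨ count-concat-tabulate p row ⟩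
  ∑[ i < n ] count p (row i)                       ≡⟨ sum-cong-≗ count-row ⟩
  gridSum (λ i j → indicator (p (i , j)))          ∎
  where
  open ≡-Reasoning
  row : Fin n → List (Vertex n m)
  row i = map (i ,_) (tabulate (λ j → j))
  count-row : ∀ i → count p (row i) ≡ ∑[ j < m ] indicator (p (i , j))
  count-row i = trans (cong (count p) (map-tabulate (λ j → j) (i ,_))) (count-tabulate p (i ,_))

rowSize : VSet n m → Fin n → ℕ
rowSize {m = m} S i = ∑[ j < m ] indicator (S (i , j))

columnSize : VSet n m → Fin m → ℕ
columnSize {n = n} S j = ∑[ i < n ] indicator (S (i , j))

size≡∑rowSize : ∀ (S : VSet n m) → size S ≡ ∑[ i < n ] rowSize S i
size≡∑rowSize = count-vertices

size≡∑columnSize : ∀ (S : VSet n m) → size S ≡ ∑[ j < m ] columnSize S j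
size≡∑columnSize S = trans (count-vertices S) (∑-comm (λ i j → indicator (S (i , j))))

-- a: same row, b: same column, s: membership; the cell itself is counted by
-- both a ∧ s and b ∧ s but is not a neighbour.
indicator-adj : ∀ a b s →
  indicator (((a ∧ not b) ∨ (not a ∧ b)) ∧ s) + 2 * indicator (b ∧ (a ∧ s))
    ≡ indicator (a ∧ s) + indicator (b ∧ s)
indicator-adj true  true  true  = refl
indicator-adj true  true  false = refl
indicator-adj true  false s     = refl
indicator-adj false true  true  = refl
indicator-adj false true  false = refl
indicator-adj false false s     = refl

nbrsIn+2*indicator≡rowSize+columnSize : ∀ (S : VSet n m) i j →
  nbrsIn S (i , j) + 2 * indicator (S (i , j)) ≡ rowSize S i + columnSize S j
nbrsIn+2*indicator≡rowSize+columnSize {n} {m} S i j = begin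
  nbrsIn S (i , j) + 2 * indicator (S (i , j))
    ≡⟨ cong₂ _+_ (count-vertices (λ v → adj (i , j) v ∧ S v)) (cong (2 *_) (sym cell)) ⟩
  gridSum neighbour + 2 * gridSum diagonal
    ≡⟨ cong (gridSum neighbour +_) (*-distribˡ-gridSum 2 diagonal) ⟩
  gridSum neighbour + gridSum (λ i′ j′ → 2 * diagonal i′ j′)
    ≡⟨ gridSum-distrib-+ neighbour _ ⟨
  gridSum (λ i′ j′ → neighbour i′ j′ + 2 * diagonal i′ j′)
    ≡⟨ gridSum-cong (λ i′ j′ → indicator-adj ⌊ i ≟ i′ ⌋ ⌊ j ≟ j′ ⌋ (S (i′ , j′))) ⟩
  gridSum (λ i′ j′ → sameRow i′ j′ + sameColumn i′ j′)
    ≡⟨ gridSum-distrib-+ sameRow sameColumn ⟩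
  gridSum sameRow + gridSum sameColumn
    ≡⟨ cong₂ _+_ row column ⟩
  rowSize S i + columnSize S j ∎
  where
  open ≡-Reasoning
  neighbour diagonal sameRow sameColumn : Fin n → Fin m → ℕ
  neighbour  i′ j′ = indicator (adj (i , j) (i′ , j′) ∧ S (i′ , j′))
  diagonal   i′ j′ = indicator (⌊ j ≟ j′ ⌋ ∧ (⌊ i ≟ i′ ⌋ ∧ S (i′ , j′)))
  sameRow    i′ j′ = indicator (⌊ i ≟ i′ ⌋ ∧ S (i′ , j′))
  sameColumn i′ j′ = indicator (⌊ j ≟ j′ ⌋ ∧ S (i′ , j′))
  cell : gridSum diagonal ≡ indicator (S (i , j))
  cell = trans (sum-cong-≗ (λ i′ → ∑-indicator-≟ j (λ j′ → ⌊ i ≟ i′ ⌋ ∧ S (i′ , j′))))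
               (∑-indicator-≟ i (λ i′ → S (i′ , j)))
  row : gridSum sameRow ≡ rowSize S i
  row = trans (∑-comm sameRow) (sum-cong-≗ (λ j′ → ∑-indicator-≟ i (λ i′ → S (i′ , j′))))
  column : gridSum sameColumn ≡ columnSize S j
  column = sum-cong-≗ (λ i′ → ∑-indicator-≟ j (λ j′ → S (i′ , j′)))

nbrsIn+indicator≡rowSize : ∀ (S : VSet 1 m) j →
  nbrsIn S (fzero , j) + indicator (S (fzero , j)) ≡ rowSize S fzero
nbrsIn+indicator≡rowSize S j = +-cancelʳ-≡ s _ _ (begin
  nbrsIn S (fzero , j) + s + s   ≡⟨ +-assoc (nbrsIn S (fzero , j)) s s ⟩
  nbrsIn S (fzero , j) + (s + s) ≡⟨ cong (λ t → nbrsIn S (fzero , j) + (s + t)) (+-identityʳ s) ⟨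
  nbrsIn S (fzero , j) + 2 * s   ≡⟨ nbrsIn+2*indicator≡rowSize+columnSize S fzero j ⟩
  rowSize S fzero + (s + 0)      ≡⟨ cong (rowSize S fzero +_) (+-identityʳ s) ⟩
  rowSize S fzero + s            ∎)
  where
  open ≡-Reasoning
  s = indicator (S (fzero , j))

∣_∣ : (Fin m → Bool) → ℕ
∣_∣ {m} C = ∑[ j < m ] indicator (C j)

columns : (Fin m → Bool) → VSet n m
columns C (_ , j) = C j

size-columns : ∀ n (C : Fin m → Bool) → size (columns {n = n} C) ≡ n * ∣ C ∣
size-columns n C = trans (size≡∑rowSize (columns {n = n} C)) (∑-const n ∣ C ∣)

columns-isKTDS : ∀ (C : Fin m → Bool) → 2 ≤ n → IsKTDS ∣ C ∣ n m (columns C)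
columns-isKTDS {n = n} C 2≤n (i , j) = +-cancelʳ-≤ (2 * s) _ _ (begin
  ∣ C ∣ + 2 * s                           ≤⟨ +-monoʳ-≤ ∣ C ∣ (*-monoˡ-≤ s 2≤n) ⟩
  ∣ C ∣ + n * s                           ≡⟨ cong (∣ C ∣ +_) (∑-const n s) ⟨
  rowSize S i + columnSize S j            ≡⟨ nbrsIn+2*indicator≡rowSize+columnSize S i j ⟨
  nbrsIn S (i , j) + 2 * s                ∎)
  where
  open ≤-Reasoning
  S = columns C
  s = indicator (C j)

columns-isKTDS-single-row : ∀ (C : Fin m → Bool) → ∣ C ∣ ≡ k + 1 → IsKTDS k 1 m (columns C)
columns-isKTDS-single-row {k = k} C ∣C∣≡ (fzero , j) = +-cancelʳ-≤ 1 _ _ (begin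
  k + 1                                   ≡⟨ ∣C∣≡ ⟨
  ∣ C ∣                                   ≡⟨ nbrsIn+indicator≡rowSize (columns C) j ⟨
  nbrsIn (columns C) (fzero , j) + indicator (C j) ≤⟨ +-monoʳ-≤ _ (indicator≤1 (C j)) ⟩
  nbrsIn (columns C) (fzero , j) + 1      ∎)
  where open ≤-Reasoning

initial : ℕ → Fin m → Bool
initial k j = toℕ j <ᵇ k

∣initial∣ : ∀ k → k ≤ m → ∣ initial {m} k ∣ ≡ k
∣initial∣ {zero}  zero    z≤n       = refl
∣initial∣ {suc m} zero    z≤n       = sum-replicate-zero m
∣initial∣ {suc m} (suc k) (s≤s k≤m) = cong suc (∣initial∣ k k≤m)

rowSize-deficit : ∀ {S : VSet n m} → IsKTDS k n m S →
  ∀ i → m * k + 2 * rowSize S i ≤ m * rowSize S i + size S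
rowSize-deficit {n} {m} {k} {S} dominating i = begin
  m * k + 2 * r                                ≡⟨ cong₂ _+_ (sym (∑-const m k)) (*-distribˡ-sum 2 s) ⟩
  ∑[ j < m ] k + ∑[ j < m ] (2 * s j)          ≡⟨ ∑-distrib-+ (λ _ → k) (λ j → 2 * s j) ⟨
  ∑[ j < m ] (k + 2 * s j)                     ≤⟨ ∑-mono-≤ (λ j → +-monoˡ-≤ (2 * s j) (dominating (i , j))) ⟩
  ∑[ j < m ] (nbrsIn S (i , j) + 2 * s j)      ≡⟨ sum-cong-≗ (nbrsIn+2*indicator≡rowSize+columnSize S i) ⟩
  ∑[ j < m ] (r + columnSize S j)              ≡⟨ ∑-distrib-+ (λ _ → r) (columnSize S) ⟩
  ∑[ j < m ] r + ∑[ j < m ] columnSize S j     ≡⟨ cong₂ _+_ (∑-const m r) (sym (size≡∑columnSize S)) ⟩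
  m * r + size S                               ∎
  where
  open ≤-Reasoning
  r = rowSize S i
  s : Fin m → ℕ
  s j = indicator (S (i , j))

-- a row with r < k cells forces |S| ≥ m k, or |S| ≥ m + 2 r when r ≥ 1
deficient-row-bound : ∀ {k n m r s} → r < k → n ≤ m → k * n ≤ m + 1 →
  m * k + 2 * r ≤ m * r + s → k * n ≤ s
deficient-row-bound {k} {n} {m} {zero} {s} _ n≤m _ bound = begin
  k * n      ≤⟨ *-monoʳ-≤ k n≤m ⟩
  k * m      ≡⟨ *-comm k m ⟩
  m * k      ≤⟨ m≤m+n (m * k) 0 ⟩
  m * k + 0  ≤⟨ bound ⟩
  m * 0 + s  ≡⟨ cong (_+ s) (*-zeroʳ m) ⟩
  s          ∎
  where open ≤-Reasoning
deficient-row-bound {k} {n} {m} {r@(suc _)} {s} r<k _ kn≤m+1 bound = begin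
  k * n      ≤⟨ kn≤m+1 ⟩
  m + 1      ≤⟨ +-monoʳ-≤ m (s≤s z≤n) ⟩
  m + 2 * r  ≤⟨ +-cancelˡ-≤ (m * r) _ _ shifted ⟩
  s          ∎
  where
  open ≤-Reasoning
  shifted : m * r + (m + 2 * r) ≤ m * r + s
  shifted = begin
    m * r + (m + 2 * r)  ≡⟨ +-assoc (m * r) m (2 * r) ⟨
    m * r + m + 2 * r    ≡⟨ cong (_+ 2 * r) (trans (*-suc m r) (+-comm m (m * r))) ⟨
    m * suc r + 2 * r    ≤⟨ +-monoˡ-≤ (2 * r) (*-monoʳ-≤ m r<k) ⟩
    m * k + 2 * r        ≤⟨ bound ⟩
    m * r + s            ∎

isKTDS⇒k*n≤size : ∀ {S : VSet n m} → n ≤ m → k * n ≤ m + 1 → IsKTDS k n m S → k * n ≤ size S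
isKTDS⇒k*n≤size {n} {m} {k} {S} n≤m kn≤m+1 dominating
  with all? (λ i → k ≤? rowSize S i)
... | yes fullRows = begin
  k * n                     ≡⟨ *-comm k n ⟩
  n * k                     ≡⟨ ∑-const n k ⟨
  ∑[ i < n ] k              ≤⟨ ∑-mono-≤ fullRows ⟩
  ∑[ i < n ] rowSize S i    ≡⟨ size≡∑rowSize S ⟨
  size S                    ∎
  where open ≤-Reasoning
... | no ¬fullRows =
  let i , k≰r = ¬∀⟶∃¬ n _ (λ i → k ≤? rowSize S i) ¬fullRows
  in deficient-row-bound (≰⇒> k≰r) n≤m kn≤m+1 (rowSize-deficit dominating i)

isKTDS⇒k+1≤size-single-row : ∀ {S : VSet 1 m} → 1 ≤ k → Fin m → IsKTDS k 1 m S → k + 1 ≤ size S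
isKTDS⇒k+1≤size-single-row {m} {k} {S} 1≤k j₀ dominating = begin
  k + 1         ≤⟨ +-monoʳ-≤ k 1≤sⱼ ⟩
  k + s j       ≤⟨ k+s≤R j ⟩
  R             ≡⟨ +-identityʳ R ⟨
  R + 0         ≡⟨ size≡∑rowSize S ⟨
  size S        ∎
  where
  open ≤-Reasoning
  R = rowSize S fzero
  s : Fin m → ℕ
  s j = indicator (S (fzero , j))
  k+s≤R : ∀ j → k + s j ≤ R
  k+s≤R j = ≤-trans (+-monoˡ-≤ (s j) (dominating (fzero , j))) (≤-reflexive (nbrsIn+indicator≡rowSize S j))
  occupied : ∃ λ j → 0 < s j
  occupied = ∑-positive s (≤-trans 1≤k (≤-trans (m≤m+n k (s j₀)) (k+s≤R j₀)))
  j = proj₁ occupied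
  1≤sⱼ = proj₂ occupied

rook-upper-bound : 2 ≤ n → k ≤ m → Σ (VSet n m) λ S → IsKTDS k n m S × size S ≡ k * n
rook-upper-bound {n} {k} {m} 2≤n k≤m =
  columns C ,
  subst (λ c → IsKTDS c n m (columns C)) ∣C∣≡ (columns-isKTDS C 2≤n) ,
  trans (size-columns n C) (trans (cong (n *_) ∣C∣≡) (*-comm n k))
  where
  C : Fin m → Bool
  C = initial k
  ∣C∣≡ : ∣ C ∣ ≡ k
  ∣C∣≡ = ∣initial∣ k k≤m

single-row-upper-bound : k + 1 ≤ m → Σ (VSet 1 m) λ S → IsKTDS k 1 m S × size S ≡ k + 1
single-row-upper-bound {k} {m} k+1≤m =
  columns C ,
  columns-isKTDS-single-row C ∣C∣≡ ,
  trans (size-columns 1 C) (trans (*-identityˡ ∣ C ∣) ∣C∣≡)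
  where
  C : Fin m → Bool
  C = initial (k + 1)
  ∣C∣≡ : ∣ C ∣ ≡ k + 1
  ∣C∣≡ = ∣initial∣ (k + 1) k+1≤m

theorem6 : (k : ℕ) → 1 ≤ k →
    ((n m : ℕ) → n ≤ m → 2 ≤ n → k ≤ m →
       γ≤ k n m (k * n) × (k * n ≤ m + 1 → γ≡ k n m (k * n)))
    × ((m : ℕ) → k + 1 ≤ m → γ≡ k 1 m (k + 1))
theorem6 k 1≤k = rook , singleRow
  where
  rook : (n m : ℕ) → n ≤ m → 2 ≤ n → k ≤ m →
    γ≤ k n m (k * n) × (k * n ≤ m + 1 → γ≡ k n m (k * n))
  rook n m n≤m 2≤n k≤m =
    let S , dominating , ∣S∣≡ = rook-upper-bound 2≤n k≤m
    in (S , dominating , ≤-reflexive ∣S∣≡) ,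
       λ kn≤m+1 → (S , dominating , ∣S∣≡) , λ _ → isKTDS⇒k*n≤size n≤m kn≤m+1
  singleRow : (m : ℕ) → k + 1 ≤ m → γ≡ k 1 m (k + 1)
  singleRow m k+1≤m =
    single-row-upper-bound k+1≤m ,
    λ _ → isKTDS⇒k+1≤size-single-row 1≤k (fromℕ< (≤-trans (m≤n+m 1 k) k+1≤m))
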